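{- For every natural number $n$, an $n$-element set has exactly $$\sum_{0\le i\le n}\binom{n}{i}2^{i(i-1)/2}$$ states in $\mathrm{CPM}(\mathbf{Rel})$.
   Context: $\mathbf{Rel}$ is the category of sets and binary relations, with dagger given by the converse relation. A relation $P: X\to X$ is positive if $P=S^\dagger\circ S$ for some set $Y$ and relation $S: X\to Y$. A state of a set $X$ in $\mathrm{CPM}(\mathbf{Rel})$ (the category of completely positive maps over $\mathbf{Rel}$) is a morphism from the one-element set $\{*\}$ to $X$ in $\mathrm{CPM}(\mathbf{Rel})$; concretely it is a positive relation $R\subseteq X\times X$. -}

module Defs where

open import Level using (0ℓ)
open import Data.Nat using (ℕ; suc; _*_; _∸_; _^_; _/_)
open import Data.Nat.Combinatorics using (_C_)
open import Data.Bool using (Bool; true)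
open import Data.Fin using (Fin)
open import Data.Vec using (Vec; lookup)
open import Data.List using (List; map; upTo)
open import Data.Nat.ListAction using (sum)
open import Data.Product using (Σ; ∃; _×_)
open import Function.Bundles using (_⇔_)
open import Relation.Binary.PropositionalEquality using (_≡_)

-- A binary relation on the n-element set Fin n, encoded as its n×n
-- Boolean incidence matrix (so that propositional equality is equality
-- of relations).
BRel : ℕ → Set
BRel n = Vec (Vec Bool n) n

_∋_,_ : ∀ {n} → BRel n → Fin n → Fin n → Set
R ∋ x , x' = lookup (lookup R x) x' ≡ true

-- Composition S† ∘ S of a relation S : X → Y with its converse:
-- x (S† ∘ S) x'  iff  ∃ y. x S y and y S† x' (i.e. x' S y).
-- R is positive iff R = S† ∘ S for some set Y and relation S : X → Y.
IsPositive : ∀ {n} → BRel n → Set₁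
IsPositive {n} R =
  Σ Set λ Y → Σ (Fin n → Y → Set) λ S →
    ∀ x x' → (R ∋ x , x') ⇔ (∃ λ y → S x y × S x' y)

countFormula : ℕ → ℕ
countFormula n = sum (map (λ i → (n C i) * 2 ^ ((i * (i ∸ 1)) / 2)) (upTo (suc n)))

-- A relation R on X is positive (R = S† ∘ S) exactly when it is symmetric
-- and diagonal-closed: x R x' implies x R x.  Such an R is determined by
-- its diagonal D = {x | x R x} (the points it touches) together with a
-- symmetric relation on D that is reflexive there; for |D| = i there are
-- 2^(i(i-1)/2) of the latter, so summing over the (n choose i) choices of
-- D gives the formula.
module Submission where

open import Defs
open import Data.Nat using (ℕ)
open import Data.List using (List; length)
open import Data.List.Relation.Unary.Unique.Propositional using (Unique)
open import Data.List.Membership.Propositional using (_∈_)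
open import Data.Product using (Σ; _×_)
open import Function.Bundles using (_⇔_)
open import Relation.Binary.PropositionalEquality using (_≡_)

open import Data.Nat using (zero; suc; _+_; _*_; _∸_; _^_; _/_; s≤s)
open import Data.Nat.Properties
  using ( +-comm; *-comm; *-assoc; *-distribˡ-+; *-distribʳ-+; +-identityʳ; ^-distribˡ-+-*
        ; suc-injective)
open import Data.Nat.Combinatorics using (_C_; nCk+nC[k+1]≡[n+1]C[k+1])
open import Data.Nat.DivMod using (m*n/n≡m)
open import Data.Nat.ListAction using (sum)
open import Data.Bool using (Bool)
open import Data.Bool.Properties using (⇔→≡)
open import Data.Fin using (Fin) renaming (zero to fzero; suc to fsuc)
open import Data.Fin.Subset
  using (Subset; ∣_∣; _⊆_; inside; outside) renaming (_∈_ to _∈ₛ_; ⊥ to ∅)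
open import Data.Fin.Subset.Properties
  using (∣p∣≤n; ∉⊥; Empty-unique; out⊆; in⊆in; drop-∷-⊆)
open import Data.Vec using (Vec; []; _∷_; lookup; tabulate; zipWith; tail; here)
import Data.Vec as Vec
open import Data.Vec.Properties
  using ( lookup-zipWith; lookup∘tabulate; tabulate-cong; ∷-injective; ∷-injectiveʳ
        ; []=⇒lookup; lookup⇒[]=)
open import Data.List using ([]; _∷_; [_]; _++_; map; concatMap; upTo)
open import Data.List.Properties using (length-++; length-map; map-cong)
open import Data.List.Membership.Propositional using (find; lose)
open import Data.List.Membership.Propositional.Properties
  using (∈-map⁺; ∈-map⁻; ∈-++⁺ˡ; ∈-++⁺ʳ; ∈-++⁻; ∈-concatMap⁺; ∈-concatMap⁻; ∈-upTo⁺)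
open import Data.List.Relation.Unary.Any using (here; there)
open import Data.Empty using (⊥; ⊥-elim)
open import Data.List.Relation.Unary.Unique.Propositional using ([]; _∷_)
import Data.List.Relation.Unary.All as All
open import Data.List.Relation.Unary.All using ([])
import Data.List.Relation.Unary.All.Properties as All
import Data.List.Relation.Unary.AllPairs as AllPairs
import Data.List.Relation.Unary.AllPairs.Properties as AllPairs
import Data.List.Relation.Unary.Unique.Propositional.Properties as Unique
open import Data.Product using (_,_; proj₁; proj₂; ∃)
open import Data.Sum using (_⊎_; inj₁; inj₂)
open import Function.Bundles using (mk⇔; module Equivalence)
open Equivalence using (to; from)
open import Relation.Binary.PropositionalEquality
  using (_≢_; refl; sym; trans; cong; cong₂; module ≡-Reasoning)

private
  variable
    A B : Set
    n : ℕ

∈-concatMap⇔ : (f : A → List B) (xs : List A) {z : B} →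
               z ∈ concatMap f xs ⇔ (∃ λ x → x ∈ xs × z ∈ f x)
∈-concatMap⇔ f xs = mk⇔ (λ z∈ → find (∈-concatMap⁻ f z∈))
                            (λ (_ , x∈xs , z∈fx) → ∈-concatMap⁺ f (lose x∈xs z∈fx))

concatMap-unique : {f : A → List B} {xs : List A} → Unique xs → (∀ x → Unique (f x)) →
                   (∀ {x y z} → z ∈ f x → z ∈ f y → x ≡ y) → Unique (concatMap f xs)
concatMap-unique {f = f} {xs} xs! f! key =
  Unique.concat⁺ (All.map⁺ (All.tabulate {xs = xs} (λ {x} _ → f! x)))
                 (AllPairs.map⁺ (AllPairs.map disjoint xs!))
  where
  disjoint : ∀ {x y} → x ≢ y → ∀ {z} → (z ∈ f x × z ∈ f y) → ⊥
  disjoint x≢y (z∈fx , z∈fy) = x≢y (key z∈fx z∈fy)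

length-concatMap : (f : A → List B) (xs : List A) →
                   length (concatMap f xs) ≡ sum (map (λ x → length (f x)) xs)
length-concatMap f []       = refl
length-concatMap f (x ∷ xs) = trans (length-++ (f x)) (cong (length (f x) +_) (length-concatMap f xs))

length-concatMap-const : (f : A → List B) (xs : List A) (c : ℕ) →
                         (∀ {x} → x ∈ xs → length (f x) ≡ c) →
                         length (concatMap f xs) ≡ length xs * c
length-concatMap-const f []       c len = refl
length-concatMap-const f (x ∷ xs) c len =
  trans (length-++ (f x))
        (cong₂ _+_ (len (here refl)) (length-concatMap-const f xs c (λ p → len (there p))))

-- Section 1: positivity is symmetry plus diagonal-closedness.

entry : BRel n → Fin n → Fin n → Bool
entry R x y = lookup (lookup R x) y

Symmetric : BRel n → Set
Symmetric R = ∀ x y → entry R x y ≡ entry R y x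

DiagonalClosed : BRel n → Set
DiagonalClosed R = ∀ x y → R ∋ x , y → R ∋ x , x

SymDiagClosed : BRel n → Set
SymDiagClosed R = Symmetric R × DiagonalClosed R

positive⇒symDiagClosed : (R : BRel n) → IsPositive R → SymDiagClosed R
positive⇒symDiagClosed R (_ , S , R≡S†S) = symmetric , diagClosed
  where
  swap : ∀ x y → R ∋ x , y → R ∋ y , x
  swap x y xRy = let s , xSs , ySs = to (R≡S†S x y) xRy
                 in from (R≡S†S y x) (s , ySs , xSs)
  symmetric : Symmetric R
  symmetric x y = ⇔→≡ (mk⇔ (swap x y) (swap y x))
  diagClosed : DiagonalClosed R
  diagClosed x y xRy = let s , xSs , _ = to (R≡S†S x y) xRy
                       in from (R≡S†S x x) (s , xSs , xSs)

-- Conversely R = S† ∘ S where S relates each point to the pairs of R it is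
-- an endpoint of.
symDiagClosed⇒positive : (R : BRel n) → SymDiagClosed R → IsPositive R
symDiagClosed⇒positive {n} R (symmetric , diagClosed) =
  (Fin n × Fin n) , S , λ x y → mk⇔ (factor x y) (compose x y)
  where
  S : Fin n → Fin n × Fin n → Set
  S x (a , b) = R ∋ a , b × (x ≡ a ⊎ x ≡ b)
  factor : ∀ x y → R ∋ x , y → ∃ λ e → S x e × S y e
  factor x y xRy = (x , y) , (xRy , inj₁ refl) , (xRy , inj₂ refl)
  compose : ∀ x y → (∃ λ e → S x e × S y e) → R ∋ x , y
  compose x y ((a , b) , (aRb , inj₁ refl) , (_ , inj₁ refl)) = diagClosed a b aRb
  compose x y ((a , b) , (aRb , inj₁ refl) , (_ , inj₂ refl)) = aRb
  compose x y ((a , b) , (aRb , inj₂ refl) , (_ , inj₁ refl)) = trans (symmetric b a) aRb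
  compose x y ((a , b) , (aRb , inj₂ refl) , (_ , inj₂ refl)) =
    diagClosed b a (trans (symmetric b a) aRb)

positive⇔symDiagClosed : (R : BRel n) → IsPositive R ⇔ SymDiagClosed R
positive⇔symDiagClosed R = mk⇔ (positive⇒symDiagClosed R) (symDiagClosed⇒positive R)

diagonal : BRel n → Subset n
diagonal R = tabulate (λ x → entry R x x)

∈-diagonal⇔ : (R : BRel n) (x : Fin n) → x ∈ₛ diagonal R ⇔ R ∋ x , x
∈-diagonal⇔ R x = mk⇔
  (λ x∈D → trans (sym (lookup∘tabulate (λ y → entry R y y) x)) ([]=⇒lookup x∈D))
  (λ xRx → lookup⇒[]= x (diagonal R) (trans (lookup∘tabulate (λ y → entry R y y) x) xRx))

-- Section 2: adding a point.

extend : Bool → Subset n → BRel n → BRel (suc n)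
extend b r R = (b ∷ r) ∷ zipWith _∷_ r R

module _ (b : Bool) (r : Subset n) (R : BRel n) where

  extend-column : ∀ j → entry (extend b r R) (fsuc j) fzero ≡ lookup r j
  extend-column j = cong (λ row → lookup row fzero) (lookup-zipWith _∷_ j r R)

  extend-inner : ∀ j k → entry (extend b r R) (fsuc j) (fsuc k) ≡ entry R j k
  extend-inner j k = cong (λ row → lookup row (fsuc k)) (lookup-zipWith _∷_ j r R)

  diagonal-extend : diagonal (extend b r R) ≡ b ∷ diagonal R
  diagonal-extend = cong (b ∷_) (tabulate-cong (λ j → extend-inner j j))

  symmetric-extend⁺ : Symmetric R → Symmetric (extend b r R)
  symmetric-extend⁺ symmetric fzero    fzero    = refl
  symmetric-extend⁺ symmetric fzero    (fsuc k) = sym (extend-column k)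
  symmetric-extend⁺ symmetric (fsuc j) fzero    = extend-column j
  symmetric-extend⁺ symmetric (fsuc j) (fsuc k) =
    trans (extend-inner j k) (trans (symmetric j k) (sym (extend-inner k j)))

  symDiagClosed-extend⁻ : SymDiagClosed (extend b r R) → SymDiagClosed R
  symDiagClosed-extend⁻ (symmetric , diagClosed) =
    (λ j k → trans (sym (extend-inner j k))
                   (trans (symmetric (fsuc j) (fsuc k)) (extend-inner k j))) ,
    (λ j k jRk → trans (sym (extend-inner j j))
                       (diagClosed (fsuc j) (fsuc k) (trans (extend-inner j k) jRk)))

symDiagClosed-outside⇔ : (r : Subset n) (R : BRel n) →
                         SymDiagClosed (extend outside r R) ⇔ (r ≡ ∅ × SymDiagClosed R)
symDiagClosed-outside⇔ r R = mk⇔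
  (λ sdc → Empty-unique (λ (j , j∈r) → isolated sdc j ([]=⇒lookup j∈r)) ,
           symDiagClosed-extend⁻ outside r R sdc)
  (λ { (refl , symmetric , diagClosed) →
         symmetric-extend⁺ outside ∅ R symmetric , closed diagClosed })
  where
  isolated : SymDiagClosed (extend outside r R) → ∀ j → lookup r j ≡ inside → ⊥
  isolated (_ , diagClosed) j rj with diagClosed fzero (fsuc j) rj
  ... | ()
  notIn∅ : ∀ j → lookup ∅ j ≡ inside → ⊥
  notIn∅ j e = ∉⊥ (lookup⇒[]= j ∅ e)
  closed : DiagonalClosed R → DiagonalClosed (extend outside ∅ R)
  closed diagClosed fzero    fzero    e = e
  closed diagClosed fzero    (fsuc k) e = ⊥-elim (notIn∅ k e)
  closed diagClosed (fsuc j) fzero    e =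
    ⊥-elim (notIn∅ j (trans (sym (extend-column outside ∅ R j)) e))
  closed diagClosed (fsuc j) (fsuc k) e =
    trans (extend-inner outside ∅ R j j)
          (diagClosed j k (trans (sym (extend-inner outside ∅ R j k)) e))

symDiagClosed-inside⇔ : (r : Subset n) (R : BRel n) →
                        SymDiagClosed (extend inside r R) ⇔ (r ⊆ diagonal R × SymDiagClosed R)
symDiagClosed-inside⇔ r R = mk⇔
  (λ sdc → (λ {j} → below sdc {j}) , symDiagClosed-extend⁻ inside r R sdc)
  (λ (r⊆D , symmetric , diagClosed) →
     symmetric-extend⁺ inside r R symmetric , closed r⊆D diagClosed)
  where
  below : SymDiagClosed (extend inside r R) → r ⊆ diagonal R
  below (_ , diagClosed) {j} j∈r = from (∈-diagonal⇔ R j)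
    (trans (sym (extend-inner inside r R j j))
           (diagClosed (fsuc j) fzero (trans (extend-column inside r R j) ([]=⇒lookup j∈r))))
  closed : r ⊆ diagonal R → DiagonalClosed R → DiagonalClosed (extend inside r R)
  closed r⊆D diagClosed fzero    k        e = refl
  closed r⊆D diagClosed (fsuc j) fzero    e =
    trans (extend-inner inside r R j j)
          (to (∈-diagonal⇔ R j)
              (r⊆D (lookup⇒[]= j r (trans (sym (extend-column inside r R j)) e))))
  closed r⊆D diagClosed (fsuc j) (fsuc k) e =
    trans (extend-inner inside r R j j)
          (diagClosed j k (trans (sym (extend-inner inside r R j k)) e))

extend-surjective : (R : BRel (suc n)) → Symmetric R →
                    ∃ λ b → ∃ λ r → ∃ λ R′ → R ≡ extend b r R′
extend-surjective ((b ∷ r) ∷ rows) symmetric =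
  b , r , Vec.map tail rows , cong ((b ∷ r) ∷_) (split rows r (λ j → symmetric (fsuc j) fzero))
  where
  split : ∀ {m} (rows : Vec (Vec Bool (suc n)) m) (c : Vec Bool m) →
          (∀ j → lookup (lookup rows j) fzero ≡ lookup c j) →
          rows ≡ zipWith _∷_ c (Vec.map tail rows)
  split []                 []      column = refl
  split ((x ∷ row) ∷ rows) (y ∷ c) column =
    cong₂ _∷_ (cong (_∷ row) (column fzero)) (split rows c (λ j → column (fsuc j)))

extend-injective : {b b′ : Bool} {r r′ : Subset n} {R R′ : BRel n} →
                   extend b r R ≡ extend b′ r′ R′ → b ≡ b′ × r ≡ r′ × R ≡ R′
extend-injective {r = r} {r′} {R} {R′} eq =
  let firstRow , rest = ∷-injective eq
      corner , row    = ∷-injective firstRow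
  in corner , row , trans (sym (tails r R)) (trans (cong (Vec.map tail) rest) (tails r′ R′))
  where
  tails : ∀ {m} (c : Vec Bool m) (rows : Vec (Vec Bool n) m) →
          Vec.map tail (zipWith _∷_ c rows) ≡ rows
  tails []      []          = refl
  tails (x ∷ c) (row ∷ rows) = cong (row ∷_) (tails c rows)

-- Section 3: the subsets of a subset.

subsets : Subset n → List (Subset n)
subsets []            = [ [] ]
subsets (outside ∷ d) = map (outside ∷_) (subsets d)
subsets (inside ∷ d)  = map (outside ∷_) (subsets d) ++ map (inside ∷_) (subsets d)

subsets-sound : (d r : Subset n) → r ∈ subsets d → r ⊆ d
subsets-sound []            r (here refl) ()
subsets-sound (outside ∷ d) r r∈ with ∈-map⁻ (outside ∷_) r∈
... | r′ , r′∈ , refl = out⊆ (subsets-sound d r′ r′∈)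
subsets-sound (inside ∷ d)  r r∈ with ∈-++⁻ (map (outside ∷_) (subsets d)) r∈
... | inj₁ r∈out with ∈-map⁻ (outside ∷_) r∈out
...   | r′ , r′∈ , refl = out⊆ (subsets-sound d r′ r′∈)
subsets-sound (inside ∷ d)  r r∈ | inj₂ r∈in with ∈-map⁻ (inside ∷_) r∈in
...   | r′ , r′∈ , refl = in⊆in (subsets-sound d r′ r′∈)

subsets-complete : (d r : Subset n) → r ⊆ d → r ∈ subsets d
subsets-complete []            []            r⊆d = here refl
subsets-complete (outside ∷ d) (outside ∷ r) r⊆d =
  ∈-map⁺ (outside ∷_) (subsets-complete d r (drop-∷-⊆ r⊆d))
subsets-complete (outside ∷ d) (inside ∷ r)  r⊆d with r⊆d here
... | ()
subsets-complete (inside ∷ d)  (outside ∷ r) r⊆d =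
  ∈-++⁺ˡ (∈-map⁺ (outside ∷_) (subsets-complete d r (drop-∷-⊆ r⊆d)))
subsets-complete (inside ∷ d)  (inside ∷ r)  r⊆d =
  ∈-++⁺ʳ (map (outside ∷_) (subsets d))
         (∈-map⁺ (inside ∷_) (subsets-complete d r (drop-∷-⊆ r⊆d)))

subsets-unique : (d : Subset n) → Unique (subsets d)
subsets-unique []            = [] ∷ []
subsets-unique (outside ∷ d) = Unique.map⁺ ∷-injectiveʳ (subsets-unique d)
subsets-unique (inside ∷ d)  =
  Unique.++⁺ (Unique.map⁺ ∷-injectiveʳ (subsets-unique d))
             (Unique.map⁺ ∷-injectiveʳ (subsets-unique d)) disjoint
  where
  disjoint : ∀ {v} → v ∈ map (outside ∷_) (subsets d) × v ∈ map (inside ∷_) (subsets d) →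
             ⊥
  disjoint (p , q) with ∈-map⁻ (outside ∷_) p | ∈-map⁻ (inside ∷_) q
  ... | _ , _ , refl | _ , _ , ()

length-subsets : (d : Subset n) → length (subsets d) ≡ 2 ^ ∣ d ∣
length-subsets []            = refl
length-subsets (outside ∷ d) = trans (length-map (outside ∷_) (subsets d)) (length-subsets d)
length-subsets (inside ∷ d)  = begin
  length (map (outside ∷_) (subsets d) ++ map (inside ∷_) (subsets d))
    ≡⟨ length-++ (map (outside ∷_) (subsets d)) ⟩
  length (map (outside ∷_) (subsets d)) + length (map (inside ∷_) (subsets d))
    ≡⟨ cong₂ _+_ (length-map (outside ∷_) (subsets d)) (length-map (inside ∷_) (subsets d)) ⟩
  length (subsets d) + length (subsets d)
    ≡⟨ cong (λ k → k + k) (length-subsets d) ⟩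
  2 ^ ∣ d ∣ + 2 ^ ∣ d ∣
    ≡⟨ cong (2 ^ ∣ d ∣ +_) (sym (+-identityʳ (2 ^ ∣ d ∣))) ⟩
  2 ^ suc ∣ d ∣ ∎
  where open ≡-Reasoning

-- Section 4: the positive relations with a given diagonal size.

PositiveOfSize : BRel n → ℕ → Set
PositiveOfSize R i = SymDiagClosed R × ∣ diagonal R ∣ ≡ i

extensionsOnDiagonal : BRel n → List (BRel (suc n))
extensionsOnDiagonal R = map (λ r → extend inside r R) (subsets (diagonal R))

-- 'positives n i' lists the relations R with PositiveOfSize R i: a new
-- point is either isolated (off the diagonal), or on the diagonal and then
-- the old relation has one diagonal point fewer.
positives : (n i : ℕ) → List (BRel n)
newOnDiagonal : (n i : ℕ) → List (BRel (suc n))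

positives zero    zero    = [ [] ]
positives zero    (suc i) = []
positives (suc n) i       = map (extend outside ∅) (positives n i) ++ newOnDiagonal n i

newOnDiagonal n zero    = []
newOnDiagonal n (suc i) = concatMap extensionsOnDiagonal (positives n i)

size-extend : (b : Bool) (r : Subset n) (R : BRel n) →
              ∣ diagonal (extend b r R) ∣ ≡ ∣ b ∷ diagonal R ∣
size-extend b r R = cong ∣_∣ (diagonal-extend b r R)

positives-sound : ∀ n i (R : BRel n) → R ∈ positives n i → PositiveOfSize R i
positives-sound zero    zero    [] _ = ((λ ()) , (λ ())) , refl
positives-sound (suc n) i       R R∈ with ∈-++⁻ (map (extend outside ∅) (positives n i)) R∈
... | inj₁ R∈old with ∈-map⁻ (extend outside ∅) R∈old
...   | R′ , R′∈ , refl =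
  let sdc , size = positives-sound n i R′ R′∈
  in from (symDiagClosed-outside⇔ ∅ R′) (refl , sdc) , trans (size-extend outside ∅ R′) size
positives-sound (suc n) (suc i) R R∈ | inj₂ R∈new
  with to (∈-concatMap⇔ extensionsOnDiagonal (positives n i)) R∈new
... | R′ , R′∈ , R∈ext with ∈-map⁻ (λ r → extend inside r R′) R∈ext
...   | r , r∈ , refl =
  let sdc , size = positives-sound n i R′ R′∈
  in from (symDiagClosed-inside⇔ r R′) (subsets-sound (diagonal R′) r r∈ , sdc) ,
     trans (size-extend inside r R′) (cong suc size)

positives-complete : ∀ n i (R : BRel n) → PositiveOfSize R i → R ∈ positives n i
positives-complete zero    zero    [] _            = here refl
positives-complete (suc n) i       R  (sdc , size) with extend-surjective R (proj₁ sdc)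
... | b , r , R′ , refl = complete b i sdc size
  where
  complete : ∀ b i → SymDiagClosed (extend b r R′) → ∣ diagonal (extend b r R′) ∣ ≡ i →
             extend b r R′ ∈ positives (suc n) i
  complete outside i sdc size with to (symDiagClosed-outside⇔ r R′) sdc
  ... | refl , sdc′ =
    let R′∈ = positives-complete n i R′ (sdc′ , trans (sym (size-extend outside r R′)) size)
    in ∈-++⁺ˡ (∈-map⁺ (extend outside ∅) R′∈)
  complete inside (suc i) sdc size with to (symDiagClosed-inside⇔ r R′) sdc
  ... | r⊆D , sdc′ =
    let size′ = suc-injective (trans (sym (size-extend inside r R′)) size)
        R′∈   = positives-complete n i R′ (sdc′ , size′)
        r∈    = subsets-complete (diagonal R′) r r⊆D
    in ∈-++⁺ʳ (map (extend outside ∅) (positives n (suc i)))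
              (from (∈-concatMap⇔ extensionsOnDiagonal (positives n i))
                    (R′ , R′∈ , ∈-map⁺ (λ r → extend inside r R′) r∈))

-- The corner entry tells the two halves of 'positives (suc n) i' apart.
corner : BRel (suc n) → Bool
corner R = entry R fzero fzero

positives-unique : ∀ n i → Unique (positives n i)
positives-unique zero    zero    = [] ∷ []
positives-unique zero    (suc i) = []
positives-unique (suc n) i       =
  Unique.++⁺ (Unique.map⁺ (λ eq → proj₂ (proj₂ (extend-injective eq))) (positives-unique n i))
             (newOnDiagonal-unique i) disjoint
  where
  extended : ∀ R {z} → z ∈ extensionsOnDiagonal R → ∀ R′ → z ∈ extensionsOnDiagonal R′ → R ≡ R′
  extended R p R′ q with ∈-map⁻ (λ r → extend inside r R) p | ∈-map⁻ (λ r → extend inside r R′) q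
  ... | _ , _ , refl | _ , _ , eq = proj₂ (proj₂ (extend-injective eq))
  newOnDiagonal-unique : ∀ i → Unique (newOnDiagonal n i)
  newOnDiagonal-unique zero    = []
  newOnDiagonal-unique (suc i) =
    concatMap-unique (positives-unique n i)
      (λ R → Unique.map⁺ (λ eq → proj₁ (proj₂ (extend-injective eq))) (subsets-unique (diagonal R)))
      (λ {R} {R′} p q → extended R p R′ q)
  old-corner : ∀ {z} → z ∈ map (extend outside ∅) (positives n i) → corner z ≡ outside
  old-corner z∈ with ∈-map⁻ (extend outside ∅) z∈
  ... | _ , _ , refl = refl
  new-corner : ∀ i {z} → z ∈ newOnDiagonal n i → corner z ≡ inside
  new-corner (suc i) z∈ with to (∈-concatMap⇔ extensionsOnDiagonal (positives n i)) z∈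
  ... | R , _ , z∈ext with ∈-map⁻ (λ r → extend inside r R) z∈ext
  ...   | _ , _ , refl = refl
  disjoint : ∀ {z} → z ∈ map (extend outside ∅) (positives n i) × z ∈ newOnDiagonal n i → ⊥
  disjoint (p , q) with trans (sym (old-corner p)) (new-corner i q)
  ... | ()

-- triangular k = k (k - 1) / 2, the number of 2-element subsets of a k-set.
triangular : ℕ → ℕ
triangular zero    = 0
triangular (suc k) = triangular k + k

triangular-double : ∀ k → triangular k * 2 ≡ k * (k ∸ 1)
triangular-double zero          = refl
triangular-double (suc zero)    = refl
triangular-double (suc (suc m)) = begin
  (triangular (suc m) + suc m) * 2      ≡⟨ *-distribʳ-+ 2 (triangular (suc m)) (suc m) ⟩
  triangular (suc m) * 2 + suc m * 2    ≡⟨ cong (_+ suc m * 2) (triangular-double (suc m)) ⟩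
  suc m * m + suc m * 2                 ≡⟨ sym (*-distribˡ-+ (suc m) m 2) ⟩
  suc m * (m + 2)                       ≡⟨ *-comm (suc m) (m + 2) ⟩
  (m + 2) * suc m                       ≡⟨ cong (_* suc m) (+-comm m 2) ⟩
  suc (suc m) * suc m                   ∎
  where open ≡-Reasoning

triangular≡ : ∀ k → triangular k ≡ (k * (k ∸ 1)) / 2
triangular≡ k = trans (sym (m*n/n≡m (triangular k) 2)) (cong (_/ 2) (triangular-double k))

-- Pascal's rule for the counts: the isolated new points contribute
-- (n C suc k) · 2^triangular (suc k); a new diagonal point can be related
-- to any of the k old diagonal points, giving (n C k) · 2^triangular k · 2^k.
length-positives : ∀ n i → length (positives n i) ≡ (n C i) * 2 ^ triangular i
length-positives zero    zero    = refl
length-positives zero    (suc i) = refl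
length-positives (suc n) zero    =
  trans (length-++ (map (extend outside ∅) (positives n zero)))
        (trans (+-identityʳ _) (trans (length-map _ (positives n zero)) (length-positives n zero)))
length-positives (suc n) (suc k) = begin
  length (map (extend outside ∅) (positives n (suc k)) ++ newOnDiagonal n (suc k))
    ≡⟨ length-++ (map (extend outside ∅) (positives n (suc k))) ⟩
  length (map (extend outside ∅) (positives n (suc k))) + length (newOnDiagonal n (suc k))
    ≡⟨ cong₂ _+_ (trans (length-map _ (positives n (suc k))) (length-positives n (suc k)))
                 (length-concatMap-const extensionsOnDiagonal (positives n k) (2 ^ k) extensions) ⟩
  (n C suc k) * X + length (positives n k) * 2 ^ k
    ≡⟨ cong (λ m → (n C suc k) * X + m * 2 ^ k) (length-positives n k) ⟩
  (n C suc k) * X + (n C k) * 2 ^ triangular k * 2 ^ k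
    ≡⟨ cong ((n C suc k) * X +_) exponents ⟩
  (n C suc k) * X + (n C k) * X
    ≡⟨ +-comm ((n C suc k) * X) _ ⟩
  (n C k) * X + (n C suc k) * X
    ≡⟨ sym (*-distribʳ-+ X (n C k) (n C suc k)) ⟩
  ((n C k) + (n C suc k)) * X
    ≡⟨ cong (_* X) (nCk+nC[k+1]≡[n+1]C[k+1] n k) ⟩
  (suc n C suc k) * X ∎
  where
  open ≡-Reasoning
  X : ℕ
  X = 2 ^ triangular (suc k)
  exponents : (n C k) * 2 ^ triangular k * 2 ^ k ≡ (n C k) * X
  exponents = trans (*-assoc (n C k) _ _) (cong ((n C k) *_) (sym (^-distribˡ-+-* 2 (triangular k) k)))
  extensions : ∀ {R} → R ∈ positives n k → length (extensionsOnDiagonal R) ≡ 2 ^ k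
  extensions {R} R∈ =
    trans (length-map _ (subsets (diagonal R)))
          (trans (length-subsets (diagonal R)) (cong (2 ^_) (proj₂ (positives-sound n k R R∈))))

corollary3p4 : (n : ℕ) →
    Σ (List (BRel n)) λ rs →
      Unique rs × (∀ (R : BRel n) → (R ∈ rs) ⇔ IsPositive R) × length rs ≡ countFormula n
corollary3p4 n = states , unique , membership , count
  where
  sizes : List ℕ
  sizes = upTo (suc n)

  states : List (BRel n)
  states = concatMap (positives n) sizes

  -- the lists for different sizes are disjoint since the size is determined
  unique : Unique states
  unique = concatMap-unique (Unique.upTo⁺ (suc n)) (positives-unique n)
    (λ {i} {j} {R} p q → trans (sym (proj₂ (positives-sound n i R p)))
                               (proj₂ (positives-sound n j R q)))

  membership : ∀ R → R ∈ states ⇔ IsPositive R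
  membership R = mk⇔
    (λ R∈ → let i , _ , R∈i = to (∈-concatMap⇔ (positives n) sizes) R∈
            in from (positive⇔symDiagClosed R) (proj₁ (positives-sound n i R R∈i)))
    (λ pos → from (∈-concatMap⇔ (positives n) sizes)
      (∣ diagonal R ∣ , ∈-upTo⁺ (s≤s (∣p∣≤n (diagonal R))) ,
       positives-complete n _ R (to (positive⇔symDiagClosed R) pos , refl)))

  count : length states ≡ countFormula n
  count = trans (length-concatMap (positives n) sizes)
    (cong sum (map-cong (λ i → trans (length-positives n i)
                                     (cong (λ e → (n C i) * 2 ^ e) (triangular≡ i)))
                        sizes))
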